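{- Let $r\ge3$ and $1<s\le r$ be integers, let $a_1,\dots,a_r\in\Omega$ be defined recursively by $a_1=(a_r,\mathrm{id})\sigma$, $a_i=(\mathrm{id},a_{i-1})$ for $2\le i\le s-1$, $a_s=(\mathrm{id},a_{s-1})\sigma$, $a_i=(a_{i-1},\mathrm{id})$ for $s+1\le i\le r$, and let $G$ be the closed subgroup of $\Omega$ topologically generated by $a_1,\dots,a_r$. Then $G$ is torsion-free.
   Context: $T$ is the regular rooted binary tree whose vertices are finite words over $\{0,1\}$; $\Omega=\mathrm{Aut}(T)$ with its profinite topology; automorphisms act on the right and $\gamma\gamma'$ means first $\gamma$ then $\gamma'$. Every $\gamma\in\Omega$ is written uniquely as $(\gamma_0,\gamma_1)\tau$ with $\tau\in\{\mathrm{id},\sigma\}$, meaning $(xv)\gamma=(x)\tau\,(v)\gamma_x$ for a letter $x$ and word $v$; $\sigma=(\mathrm{id},\mathrm{id})\sigma$ swaps the first letter. Multiplication: $(\gamma_0,\gamma_1)\tau\cdot(\gamma_0',\gamma_1')\tau'=(\gamma_0\gamma'_{(0)\tau},\gamma_1\gamma'_{(1)\tau})\tau\tau'$. -}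

module Defs where

open import Data.Bool using (Bool; true; false; _xor_; _∨_; if_then_else_)
open import Data.List using (List; []; _∷_; length)
open import Data.Nat using (ℕ; zero; suc; pred; _≤_; _<_; _≡ᵇ_; _≤ᵇ_)
open import Data.Product using (Σ; _×_)
open import Relation.Binary.PropositionalEquality using (_≡_)

-- Letters of the alphabet {0,1}: false = 0, true = 1.
-- Vertices of T: finite words  List Bool.

-- An automorphism γ ∈ Ω = Aut(T) is represented by its portrait:
-- γ w = true  iff the section γ_w = (.,.)τ has τ = σ (swaps the first letter).
Ω : Set
Ω = List Bool → Bool

_≈_ : Ω → Ω → Set
g ≈ h = ∀ w → g w ≡ h w

root : Ω → Bool
root g = g []

sec : Ω → Bool → Ω
sec g x w = g (x ∷ w)

act : Ω → List Bool → List Bool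
act g []      = []
act g (x ∷ v) = (x xor root g) ∷ act (sec g x) v

idΩ : Ω
idΩ _ = false

wr : Ω → Ω → Bool → Ω
wr g₀ g₁ τ []          = τ
wr g₀ g₁ τ (false ∷ w) = g₀ w
wr g₀ g₁ τ (true ∷ w)  = g₁ w

-- product γγ' : first γ then γ'
-- (γ₀,γ₁)τ · (γ₀',γ₁')τ' = (γ₀ γ'_{(0)τ}, γ₁ γ'_{(1)τ}) ττ'
_·_ : Ω → Ω → Ω
(g · h) []      = root g xor root h
(g · h) (x ∷ w) = (sec g x · sec h (x xor root g)) w

_⁻¹ : Ω → Ω
(g ⁻¹) []      = root g
(g ⁻¹) (x ∷ w) = (sec g (x xor root g) ⁻¹) w

_^_ : Ω → ℕ → Ω
g ^ zero  = idΩ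
g ^ suc k = g · (g ^ k)

-- The generators a_i (1 ≤ i ≤ r) for parameters r, s, defined by the
-- recursion
--   a_1 = (a_r, id) σ
--   a_i = (id, a_{i-1})      for 2 ≤ i ≤ s-1
--   a_s = (id, a_{s-1}) σ
--   a_i = (a_{i-1}, id)      for s+1 ≤ i ≤ r
-- (structural recursion on the vertex; values for i ∉ [1,r] are irrelevant).
gen : (r s : ℕ) → ℕ → Ω
gen r s i []      = (i ≡ᵇ 1) ∨ (i ≡ᵇ s)
gen r s i (x ∷ w) =
  if (i ≡ᵇ 1) then (if x then false else gen r s r w)
  else if (i ≤ᵇ s) then (if x then gen r s (pred i) w else false)
  else (if x then false else gen r s (pred i) w)

data InGen (r s : ℕ) : Ω → Set where
  g-gen : ∀ i → 1 ≤ i → i ≤ r → InGen r s (gen r s i)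
  g-id  : InGen r s idΩ
  g-mul : ∀ {g h} → InGen r s g → InGen r s h → InGen r s (g · h)
  g-inv : ∀ {g} → InGen r s g → InGen r s (g ⁻¹)

-- Its closure G in the profinite topology: g ∈ G iff every basic
-- neighbourhood of g (agreement on all vertices of length < n, i.e. the
-- coset of the n-th level stabiliser) meets the generated subgroup.
InG : (r s : ℕ) → Ω → Set
InG r s g = ∀ (n : ℕ) → Σ Ω (λ h → InGen r s h × (∀ w → length w < n → g w ≡ h w))

TorsionFree : (Ω → Set) → Set
TorsionFree P = ∀ g → P g → ∀ (k : ℕ) → 1 ≤ k → (g ^ k) ≈ idΩ → g ≈ idΩ

{-# OPTIONS --safe #-}
module Submission where

-- Let π_n(g) be the parity of the number of level-n vertices at which g swaps; each π_n is a
-- homomorphism Ω → Bool. Every a_i has one trivial section and the other equal to a_{i-1}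
-- (indices mod r), so π_r(a_i) = π_0(a_i). Hence every section h of every element of G
-- satisfies π_r(h) = π_0(h), a condition on finitely many levels, which therefore survives
-- passing to the closure. Such a g with g^k = 1, k ≥ 1, is trivial by induction on k: if g
-- fixes the root, its sections also have order dividing k; if g swaps, k = 2m is even and
-- h = g_0 g_1 (the section of g² at 0) satisfies h^m = 1, so h = 1 by induction, whence
-- π_r(g) = π_{r-1}(g_0) + π_{r-1}(g_1) = π_{r-1}(h) = 0 ≠ π_0(g).

open import Defs
open import Data.Nat using (ℕ; zero; suc; pred; _+_; _*_; _≤_; _<_; z≤n; s≤s; _≡ᵇ_; _≤ᵇ_)
open import Data.Nat.Properties using (+-suc; +-comm; +-identityʳ; +-monoʳ-<; m<m*n; m≤n⇒∃[o]m+o≡n; ≤-trans; n≤1+n; ≤-refl)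
open import Data.Nat.Induction using (<-wellFounded)
open import Data.Nat.GeneralisedArithmetic using (iterate)
open import Induction.WellFounded using (Acc; acc)
open import Data.Bool using (Bool; true; false; _xor_; if_then_else_)
open import Data.Bool.Properties using (xor-assoc; xor-comm; xor-identityʳ; xor-∧-commutativeRing)
open import Algebra.Bundles using (CommutativeRing)
open import Algebra.Properties.CommutativeSemigroup (CommutativeRing.+-commutativeSemigroup xor-∧-commutativeRing) using (interchange)
open import Data.List using (List; []; _∷_; length; _++_)
open import Data.List.Properties using (length-++)
open import Data.Product using (_×_; _,_)
open import Data.Sum using (_⊎_; inj₁; inj₂)
open import Relation.Binary.PropositionalEquality using (_≡_; refl; sym; trans; cong; cong₂; subst; module ≡-Reasoning)

≈-refl : ∀ {g} → g ≈ g
≈-refl _ = refl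

≈-sym : ∀ {g h} → g ≈ h → h ≈ g
≈-sym g≈h w = sym (g≈h w)

·-cong : ∀ {g g′ h h′} → g ≈ g′ → h ≈ h′ → (g · h) ≈ (g′ · h′)
·-cong g≈g′ h≈h′ []      = cong₂ _xor_ (g≈g′ []) (h≈h′ [])
·-cong g≈g′ h≈h′ (x ∷ w) rewrite g≈g′ [] =
  ·-cong (λ u → g≈g′ (x ∷ u)) (λ u → h≈h′ (_ ∷ u)) w

·-assoc : ∀ g h k → ((g · h) · k) ≈ (g · (h · k))
·-assoc g h k []      = xor-assoc (g []) (h []) (k [])
·-assoc g h k (x ∷ w) = begin
  ((sec g x · sec h (x xor g [])) · sec k (x xor (g [] xor h []))) w
    ≡⟨ ·-assoc (sec g x) (sec h (x xor g [])) (sec k (x xor (g [] xor h []))) w ⟩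
  (sec g x · (sec h (x xor g []) · sec k (x xor (g [] xor h [])))) w
    ≡⟨ cong (λ y → (sec g x · (sec h (x xor g []) · sec k y)) w) (sym (xor-assoc x (g []) (h []))) ⟩
  (sec g x · (sec h (x xor g []) · sec k ((x xor g []) xor h []))) w ∎
  where open ≡-Reasoning

sec* : Ω → List Bool → Ω
sec* g v w = g (v ++ w)

sec*-cong : ∀ {g h} v → g ≈ h → sec* g v ≈ sec* h v
sec*-cong v g≈h w = g≈h (v ++ w)

sec*-· : ∀ g h v → sec* (g · h) v ≈ (sec* g v · sec* h (act g v))
sec*-· g h []      w = refl
sec*-· g h (x ∷ v) w = sec*-· (sec g x) (sec h (x xor g [])) v w

sec*-⁻¹ : ∀ g v → sec* (g ⁻¹) v ≈ (sec* g (act (g ⁻¹) v) ⁻¹)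
sec*-⁻¹ g []      w = refl
sec*-⁻¹ g (x ∷ v) w = sec*-⁻¹ (sec g (x xor g [])) v w

AgreeBelow : ℕ → Ω → Ω → Set
AgreeBelow n g h = ∀ w → length w < n → g w ≡ h w

sec*-agreeBelow : ∀ {g h} v n → AgreeBelow (length v + n) g h → AgreeBelow n (sec* g v) (sec* h v)
sec*-agreeBelow v n g≈h w |w|<n =
  g≈h (v ++ w) (subst (_< length v + n) (sym (length-++ v)) (+-monoʳ-< (length v) |w|<n))

levelParity : Ω → ℕ → Bool
levelParity g zero    = root g
levelParity g (suc n) = levelParity (sec g false) n xor levelParity (sec g true) n

levelParity-agreeBelow : ∀ {g h} n → AgreeBelow (suc n) g h → levelParity g n ≡ levelParity h n
levelParity-agreeBelow zero    g≈h = g≈h [] (s≤s z≤n)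
levelParity-agreeBelow (suc n) g≈h =
  cong₂ _xor_ (levelParity-agreeBelow n (λ w l → g≈h (false ∷ w) (s≤s l)))
              (levelParity-agreeBelow n (λ w l → g≈h (true ∷ w) (s≤s l)))

levelParity-cong : ∀ {g h} n → g ≈ h → levelParity g n ≡ levelParity h n
levelParity-cong n g≈h = levelParity-agreeBelow n (λ w _ → g≈h w)

levelParity-idΩ : ∀ n → levelParity idΩ n ≡ false
levelParity-idΩ zero    = refl
levelParity-idΩ (suc n) = cong₂ _xor_ (levelParity-idΩ n) (levelParity-idΩ n)

xor-translate : ∀ (f : Bool → Bool) τ → f (false xor τ) xor f (true xor τ) ≡ f false xor f true
xor-translate f false = refl
xor-translate f true  = xor-comm (f true) (f false)

levelParity-· : ∀ g h n → levelParity (g · h) n ≡ levelParity g n xor levelParity h n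
levelParity-· g h zero    = refl
levelParity-· g h (suc n) = begin
  levelParity (sec g false · sec h (false xor g [])) n xor levelParity (sec g true · sec h (true xor g [])) n
    ≡⟨ cong₂ _xor_ (levelParity-· (sec g false) (sec h (false xor g [])) n)
                   (levelParity-· (sec g true) (sec h (true xor g [])) n) ⟩
  (p g false xor p h (false xor g [])) xor (p g true xor p h (true xor g []))
    ≡⟨ interchange (p g false) (p h (false xor g [])) (p g true) (p h (true xor g [])) ⟩
  (p g false xor p g true) xor (p h (false xor g []) xor p h (true xor g []))
    ≡⟨ cong (levelParity g (suc n) xor_) (xor-translate (p h) (g [])) ⟩
  levelParity g (suc n) xor levelParity h (suc n) ∎
  where
  open ≡-Reasoning
  p : Ω → Bool → Bool
  p k x = levelParity (sec k x) n

levelParity-⁻¹ : ∀ g n → levelParity (g ⁻¹) n ≡ levelParity g n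
levelParity-⁻¹ g zero    = refl
levelParity-⁻¹ g (suc n) =
  trans (cong₂ _xor_ (levelParity-⁻¹ (sec g (false xor g [])) n) (levelParity-⁻¹ (sec g (true xor g [])) n))
        (xor-translate (λ x → levelParity (sec g x) n) (g []))

record IsSubgroup (P : Ω → Set) : Set where
  field
    resp-≈  : ∀ {g h} → g ≈ h → P g → P h
    idΩ-∈   : P idΩ
    ·-∈     : ∀ {g h} → P g → P h → P (g · h)
    ⁻¹-∈    : ∀ {g} → P g → P (g ⁻¹)

InGen⊆ : ∀ {r s P} → IsSubgroup P → (∀ i → 1 ≤ i → i ≤ r → P (gen r s i)) → ∀ {g} → InGen r s g → P g
InGen⊆ {P = P} P-subgroup gens-∈ = go
  where
  open IsSubgroup P-subgroup
  go : ∀ {g} → InGen _ _ g → P g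
  go (g-gen i 1≤i i≤r) = gens-∈ i 1≤i i≤r
  go g-id              = idΩ-∈
  go (g-mul g∈ h∈)     = ·-∈ (go g∈) (go h∈)
  go (g-inv g∈)        = ⁻¹-∈ (go g∈)

Hereditary : (Ω → Set) → Ω → Set
Hereditary P g = ∀ v → P (sec* g v)

Hereditary-isSubgroup : ∀ {P} → IsSubgroup P → IsSubgroup (Hereditary P)
Hereditary-isSubgroup {P} P-subgroup = record
  { resp-≈ = λ g≈h Pg v → resp-≈ (sec*-cong v g≈h) (Pg v)
  ; idΩ-∈  = λ _ → idΩ-∈
  ; ·-∈    = λ {g} {h} Pg Ph v → resp-≈ (≈-sym (sec*-· g h v)) (·-∈ (Pg v) (Ph (act g v)))
  ; ⁻¹-∈   = λ {g} Pg v → resp-≈ (≈-sym (sec*-⁻¹ g v)) (⁻¹-∈ (Pg (act (g ⁻¹) v)))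
  }
  where open IsSubgroup P-subgroup

ParityMatchesRoot : ℕ → Ω → Set
ParityMatchesRoot n g = levelParity g n ≡ root g

ParityMatchesRoot-isSubgroup : ∀ n → IsSubgroup (ParityMatchesRoot n)
ParityMatchesRoot-isSubgroup n = record
  { resp-≈ = λ g≈h Pg → trans (sym (levelParity-cong n g≈h)) (trans Pg (g≈h []))
  ; idΩ-∈  = levelParity-idΩ n
  ; ·-∈    = λ {g} {h} Pg Ph → trans (levelParity-· g h n) (cong₂ _xor_ Pg Ph)
  ; ⁻¹-∈   = λ {g} Pg → trans (levelParity-⁻¹ g n) Pg
  }

ParityMatchesRoot-agreeBelow : ∀ {g h} n → AgreeBelow (suc n) g h → ParityMatchesRoot n h → ParityMatchesRoot n g
ParityMatchesRoot-agreeBelow n g≈h Ph = trans (levelParity-agreeBelow n g≈h) (trans Ph (sym (g≈h [] (s≤s z≤n))))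

^-sec-rootFixed : ∀ {g} → root g ≡ false → ∀ k x → sec (g ^ k) x ≈ (sec g x ^ k)
^-sec-rootFixed         root≡false zero    x w = refl
^-sec-rootFixed {g} root≡false (suc k) x w = begin
  (sec g x · sec (g ^ k) (x xor g [])) w   ≡⟨ cong (λ y → (sec g x · sec (g ^ k) (x xor y)) w) root≡false ⟩
  (sec g x · sec (g ^ k) (x xor false)) w  ≡⟨ cong (λ y → (sec g x · sec (g ^ k) y) w) (xor-identityʳ x) ⟩
  (sec g x · sec (g ^ k) x) w              ≡⟨ ·-cong ≈-refl (^-sec-rootFixed root≡false k x) w ⟩
  (sec g x · (sec g x ^ k)) w              ∎
  where open ≡-Reasoning

root-^-even : ∀ {g} → root g ≡ true → ∀ m → root (g ^ (m * 2)) ≡ false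
root-^-even root≡true zero    = refl
root-^-even root≡true (suc m) = cong₂ (λ a b → a xor (a xor b)) root≡true (root-^-even root≡true m)

root-^-odd : ∀ {g} → root g ≡ true → ∀ m → root (g ^ suc (m * 2)) ≡ true
root-^-odd root≡true m = cong₂ _xor_ root≡true (root-^-even root≡true m)

^-sec-even : ∀ {g} → root g ≡ true → ∀ m → sec (g ^ (m * 2)) false ≈ ((sec g false · sec g true) ^ m)
^-sec-even         root≡true zero    w = refl
^-sec-even {g} root≡true (suc m) w = begin
  (g₀ · sec (g ^ suc (m * 2)) (false xor g [])) w  ≡⟨ cong (λ y → (g₀ · sec (g ^ suc (m * 2)) (false xor y)) w) root≡true ⟩
  (g₀ · (g₁ · sec (g ^ (m * 2)) (true xor g []))) w ≡⟨ cong (λ y → (g₀ · (g₁ · sec (g ^ (m * 2)) (true xor y))) w) root≡true ⟩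
  (g₀ · (g₁ · sec (g ^ (m * 2)) false)) w           ≡⟨ ·-cong ≈-refl (·-cong ≈-refl (^-sec-even root≡true m)) w ⟩
  (g₀ · (g₁ · ((g₀ · g₁) ^ m))) w                   ≡⟨ sym (·-assoc g₀ g₁ ((g₀ · g₁) ^ m) w) ⟩
  ((g₀ · g₁) · ((g₀ · g₁) ^ m)) w                   ∎
  where
  open ≡-Reasoning
  g₀ g₁ : Ω
  g₀ = sec g false
  g₁ = sec g true

data EvenOrOdd : ℕ → Set where
  even : ∀ m → EvenOrOdd (m * 2)
  odd  : ∀ m → EvenOrOdd (suc (m * 2))

evenOrOdd : ∀ k → EvenOrOdd k
evenOrOdd zero = even 0
evenOrOdd (suc k) with evenOrOdd k
... | even m = odd m
... | odd m  = even (suc m)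

rootFixed⇒trivial : ∀ P k → (∀ {g} → Hereditary P g → (g ^ k) ≈ idΩ → root g ≡ false) →
                    ∀ {g} → Hereditary P g → (g ^ k) ≈ idΩ → g ≈ idΩ
rootFixed⇒trivial P k rootFixed Pg gᵏ≈id []      = rootFixed Pg gᵏ≈id
rootFixed⇒trivial P k rootFixed Pg gᵏ≈id (x ∷ w) =
  rootFixed⇒trivial P k rootFixed (λ v → Pg (x ∷ v))
    (λ u → trans (sym (^-sec-rootFixed (rootFixed Pg gᵏ≈id) k x u)) (gᵏ≈id (x ∷ u))) w

torsion⇒rootFixed : ∀ n {k} → Acc _<_ k → 1 ≤ k → ∀ {g} → Hereditary (ParityMatchesRoot (suc n)) g →
                    (g ^ k) ≈ idΩ → root g ≡ false
torsion⇒rootFixed n {k} (acc rec) 1≤k {g} Pg gᵏ≈id with g [] in root≡true | evenOrOdd k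
... | false | _            = refl
... | true  | odd m        = trans (sym (root-^-odd {g} root≡true m)) (gᵏ≈id [])
... | true  | even (suc m) = begin
  true                                   ≡⟨ sym root≡true ⟩
  root g                                 ≡⟨ sym (Pg []) ⟩
  levelParity g₀ n xor levelParity g₁ n  ≡⟨ sym (levelParity-· g₀ g₁ n) ⟩
  levelParity (g₀ · g₁) n                ≡⟨ levelParity-cong n g₀g₁≈id ⟩
  levelParity idΩ n                      ≡⟨ levelParity-idΩ n ⟩
  false                                  ∎
  where
  open ≡-Reasoning
  open IsSubgroup (Hereditary-isSubgroup (ParityMatchesRoot-isSubgroup (suc n)))
  g₀ g₁ : Ω
  g₀ = sec g false
  g₁ = sec g true
  m<k : suc m < suc m * 2
  m<k = m<m*n (suc m) 2 (s≤s (s≤s z≤n))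
  g₀g₁≈id : (g₀ · g₁) ≈ idΩ
  g₀g₁≈id = rootFixed⇒trivial (ParityMatchesRoot (suc n)) (suc m) (torsion⇒rootFixed n (rec m<k) (s≤s z≤n))
              (·-∈ (λ v → Pg (false ∷ v)) (λ v → Pg (true ∷ v)))
              (λ w → trans (sym (^-sec-even root≡true (suc m) w)) (gᵏ≈id (false ∷ w)))

Hereditary-torsionFree : ∀ n → TorsionFree (Hereditary (ParityMatchesRoot (suc n)))
Hereditary-torsionFree n g Pg k 1≤k =
  rootFixed⇒trivial (ParityMatchesRoot (suc n)) k (torsion⇒rootFixed n (<-wellFounded k) 1≤k) Pg

cyclicPred : ℕ → ℕ → ℕ
cyclicPred r i = if i ≡ᵇ 1 then r else pred i

iterate-cyclicPred-descend : ∀ r n i m → iterate (cyclicPred r) (suc (n + i)) (n + m) ≡ iterate (cyclicPred r) (suc i) m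
iterate-cyclicPred-descend r zero    i m = refl
iterate-cyclicPred-descend r (suc n) i m = iterate-cyclicPred-descend r n i m

iterate-cyclicPred-period : ∀ {r i} → 1 ≤ i → i ≤ r → iterate (cyclicPred r) i r ≡ i
iterate-cyclicPred-period {r} {suc i} _ i≤r with m≤n⇒∃[o]m+o≡n i≤r
... | t , refl = begin
  iterate f (suc i) (suc (i + t))        ≡⟨ cong₂ (λ a b → iterate f (suc a) b) (sym (+-identityʳ i)) (sym (+-suc i t)) ⟩
  iterate f (suc (i + 0)) (i + suc t)    ≡⟨ iterate-cyclicPred-descend (suc (i + t)) i 0 (suc t) ⟩
  iterate f (suc (i + t)) t              ≡⟨ cong₂ (λ a b → iterate f (suc a) b) (+-comm i t) (sym (+-identityʳ t)) ⟩
  iterate f (suc (t + i)) (t + 0)        ≡⟨ iterate-cyclicPred-descend (suc (i + t)) t i 0 ⟩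
  suc i                                  ∎
  where
  open ≡-Reasoning
  f : ℕ → ℕ
  f = cyclicPred (suc (i + t))

OneSectionTrivial : Ω → Ω → Set
OneSectionTrivial g h = (sec g false ≈ h × sec g true ≈ idΩ) ⊎ (sec g false ≈ idΩ × sec g true ≈ h)

gen-sections : ∀ r s i → OneSectionTrivial (gen r s i) (gen r s (cyclicPred r i))
gen-sections r s i with i ≡ᵇ 1 | i ≤ᵇ s
... | true  | _     = inj₁ (≈-refl , ≈-refl)
... | false | true  = inj₂ (≈-refl , ≈-refl)
... | false | false = inj₁ (≈-refl , ≈-refl)

levelParity-oneSectionTrivial : ∀ {g h} → OneSectionTrivial g h → ∀ n → levelParity g (suc n) ≡ levelParity h n
levelParity-oneSectionTrivial (inj₁ (g₀≈h , g₁≈id)) n =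
  trans (cong₂ _xor_ (levelParity-cong n g₀≈h) (trans (levelParity-cong n g₁≈id) (levelParity-idΩ n)))
        (xor-identityʳ _)
levelParity-oneSectionTrivial (inj₂ (g₀≈id , g₁≈h)) n =
  cong₂ _xor_ (trans (levelParity-cong n g₀≈id) (levelParity-idΩ n)) (levelParity-cong n g₁≈h)

sec*-oneSectionTrivial : ∀ {P} → IsSubgroup P → ∀ {g h} → OneSectionTrivial g h →
                         ∀ x v → P (sec* h v) → P (sec* g (x ∷ v))
sec*-oneSectionTrivial P-subgroup (inj₁ (g₀≈h , _))  false v Ph = IsSubgroup.resp-≈ P-subgroup (sec*-cong v (≈-sym g₀≈h)) Ph
sec*-oneSectionTrivial P-subgroup (inj₁ (_ , g₁≈id)) true  v _  = IsSubgroup.resp-≈ P-subgroup (sec*-cong v (≈-sym g₁≈id))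
                                                                    (IsSubgroup.idΩ-∈ P-subgroup)
sec*-oneSectionTrivial P-subgroup (inj₂ (g₀≈id , _)) false v _  = IsSubgroup.resp-≈ P-subgroup (sec*-cong v (≈-sym g₀≈id))
                                                                    (IsSubgroup.idΩ-∈ P-subgroup)
sec*-oneSectionTrivial P-subgroup (inj₂ (_ , g₁≈h))  true  v Ph = IsSubgroup.resp-≈ P-subgroup (sec*-cong v (≈-sym g₁≈h)) Ph

levelParity-gen : ∀ r s i n → levelParity (gen r s i) n ≡ root (gen r s (iterate (cyclicPred r) i n))
levelParity-gen r s i zero    = refl
levelParity-gen r s i (suc n) =
  trans (levelParity-oneSectionTrivial {gen r s i} (gen-sections r s i) n) (levelParity-gen r s (cyclicPred r i) n)

cyclicPred-range : ∀ {r i} → 1 ≤ i → i ≤ r → 1 ≤ cyclicPred r i × cyclicPred r i ≤ r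
cyclicPred-range {i = suc zero}    _ 1≤r    = 1≤r , ≤-refl
cyclicPred-range {i = suc (suc i)} _ 2+i≤r = s≤s z≤n , ≤-trans (n≤1+n _) 2+i≤r

gen-hereditary : ∀ r s i → 1 ≤ i → i ≤ r → Hereditary (ParityMatchesRoot r) (gen r s i)
gen-hereditary r s i 1≤i i≤r [] =
  trans (levelParity-gen r s i r) (cong (λ j → root (gen r s j)) (iterate-cyclicPred-period 1≤i i≤r))
gen-hereditary r s i 1≤i i≤r (x ∷ v) with cyclicPred-range 1≤i i≤r
... | 1≤i′ , i′≤r = sec*-oneSectionTrivial (ParityMatchesRoot-isSubgroup r) {gen r s i} (gen-sections r s i) x v
                      (gen-hereditary r s (cyclicPred r i) 1≤i′ i′≤r v)

InG⊆Hereditary : ∀ r s {g} → InG r s g → Hereditary (ParityMatchesRoot r) g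
InG⊆Hereditary r s g∈G v with g∈G (length v + suc r)
... | h , h∈⟨a⟩ , g≈h = ParityMatchesRoot-agreeBelow r (sec*-agreeBelow v (suc r) g≈h)
                          (InGen⊆ (Hereditary-isSubgroup (ParityMatchesRoot-isSubgroup r)) (gen-hereditary r s) h∈⟨a⟩ v)

theorem6p8 : (r s : ℕ) → 3 ≤ r → 1 < s → s ≤ r → TorsionFree (InG r s)
theorem6p8 (suc r′) s _ _ _ g g∈G = Hereditary-torsionFree r′ g (InG⊆Hereditary (suc r′) s g∈G)
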